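{- Let $s,t$ be positive integers and $r=s+4$. Let $T^{r}_{s,t}$ be the tree with vertex set $\{v_0,v_1,v_2,v_3,v_4\}\cup\{p_1,\ldots,p_s\}\cup\{q_1,\ldots,q_s\}\cup\{w_1,\ldots,w_t\}$ (all distinct) and edge set $\{v_0v_1,v_1v_2,v_2v_3,v_3v_4\}\cup\{p_iq_i: 1\le i\le s\}\cup\{v_2w_i:1\le i\le t\}\cup\{v_2p_i:1\le i\le s\}$. Then $\nu_2(T^{r}_{s,t})=r$.
   Context: For a graph $G$, a 2-packing is a set $R\subseteq E(G)$ such that no three edges of $R$ are incident with a common vertex (equivalently, every vertex is incident with at most two edges of $R$). The 2-packing number $\nu_2(G)$ is the maximum size of a 2-packing. -}

module Defs where

open import Data.Nat using (ℕ; _+_; _≤_)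
open import Data.Fin using (Fin)
open import Data.Product using (_×_; _,_; Σ; ∃)
open import Data.List using (List; length; filter)
open import Data.List.Relation.Unary.Unique.Propositional using (Unique)
open import Relation.Binary.PropositionalEquality using (_≡_)
open import Relation.Nullary using (¬_)
open import Data.Sum using (_⊎_)
open import Data.Empty using (⊥)
open import Data.List.Membership.Propositional using (_∈_)
open import Data.Fin using (zero; suc; inject₁)

record Graph : Set₁ where
  field
    V   : Set
    E   : Set
    ends : E → V × V

open Graph public

Incident : (G : Graph) → E G → V G → Set
Incident G e x with ends G e
... | (a , b) = (a ≡ x) ⊎ (b ≡ x)

IsTwoPacking : (G : Graph) → List (E G) → Set
IsTwoPacking G R =
  Unique R ×
  (∀ (x : V G) (e₁ e₂ e₃ : E G) →
     e₁ ∈ R → e₂ ∈ R → e₃ ∈ R →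
     Incident G e₁ x → Incident G e₂ x → Incident G e₃ x →
     ¬ e₁ ≡ e₂ → ¬ e₁ ≡ e₃ → ¬ e₂ ≡ e₃ → ⊥)

TwoPackingNumberIs : (G : Graph) → ℕ → Set
TwoPackingNumberIs G k =
  (Σ (List (E G)) λ R → IsTwoPacking G R × length R ≡ k) ×
  (∀ (R : List (E G)) → IsTwoPacking G R → length R ≤ k)

data TVertex (s t : ℕ) : Set where
  v : Fin 5 → TVertex s t
  p : Fin s → TVertex s t
  q : Fin s → TVertex s t
  w : Fin t → TVertex s t

data TEdge (s t : ℕ) : Set where
  path : Fin 4 → TEdge s t
  pq   : Fin s → TEdge s t
  v2w  : Fin t → TEdge s t
  v2p  : Fin s → TEdge s t

v₂ : Fin 5
v₂ = suc (suc zero)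

tEnds : (s t : ℕ) → TEdge s t → TVertex s t × TVertex s t
tEnds s t (path j) = v (inject₁ j) , v (suc j)
tEnds s t (pq i)   = p i , q i
tEnds s t (v2w i)  = v v₂ , w i
tEnds s t (v2p i)  = v v₂ , p i

T : (s t : ℕ) → Graph
T s t = record { V = TVertex s t ; E = TEdge s t ; ends = tEnds s t }

-- A 2-packing contains at most two of the edges at v₂, and the remaining edges of the tree,
-- v₀v₁, v₃v₄ and the s edges pᵢqᵢ, number s + 2; so ν₂ ≤ s + 4. Conversely the path v₀v₁v₂v₃v₄
-- together with the matching {pᵢqᵢ} has maximum degree 2 and s + 4 edges.
module Submission where

open import Defs
open import Data.Nat using (ℕ; suc; _+_; _≤_; z≤n; s≤s)
open import Data.Nat.Properties using (+-comm; +-suc; +-mono-≤; module ≤-Reasoning)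
open import Data.Fin using (Fin; zero; suc)
open import Data.Fin.Properties using (injective⇒≤)
open import Data.List using (List; []; _∷_; length; lookup; tabulate; filter)
open import Data.List.Properties using (length-tabulate)
open import Data.List.Relation.Unary.All as All using (All; []; _∷_)
open import Data.List.Relation.Unary.All.Properties using (all-filter)
open import Data.List.Relation.Unary.Any using (here; there)
open import Data.List.Relation.Unary.AllPairs using ([]; _∷_)
open import Data.List.Relation.Unary.Unique.Propositional using (Unique)
open import Data.List.Relation.Unary.Unique.Propositional.Properties using (filter⁺; tabulate⁺)
open import Data.List.Membership.Propositional using (_∈_)
open import Data.List.Membership.Propositional.Properties using (∈-lookup; ∈-filter⁻; ∈-tabulate⁻)
open import Data.Product using (_,_; proj₁; proj₂)
open import Data.Sum using (inj₁; inj₂)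
open import Data.Empty using (⊥; ⊥-elim)
open import Relation.Binary.PropositionalEquality using (_≡_; refl; sym; trans; cong; module ≡-Reasoning)
open import Relation.Nullary using (¬_; yes; no)
open import Relation.Unary using (Decidable)
open import Relation.Unary.Properties using (∁?)

module _ {A : Set} where

  InjectiveOn : {B : Set} → (A → B) → List A → Set
  InjectiveOn f xs = ∀ {x y} → x ∈ xs → y ∈ xs → f x ≡ f y → x ≡ y

  Unique-lookup-injective : {xs : List A} → Unique xs →
    ∀ i j → lookup xs i ≡ lookup xs j → i ≡ j
  Unique-lookup-injective (_ ∷ _)     zero    zero    _  = refl
  Unique-lookup-injective (x∉ ∷ _)    zero    (suc j) eq = ⊥-elim (All.lookup x∉ (∈-lookup j) eq)
  Unique-lookup-injective (x∉ ∷ _)    (suc i) zero    eq = ⊥-elim (All.lookup x∉ (∈-lookup i) (sym eq))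
  Unique-lookup-injective (_ ∷ uniq)  (suc i) (suc j) eq = cong suc (Unique-lookup-injective uniq i j eq)

  Unique-length≤ : ∀ {n xs} (f : A → Fin n) → InjectiveOn f xs → Unique xs → length xs ≤ n
  Unique-length≤ f f-inj uniq = injective⇒≤ λ {i} {j} eq →
    Unique-lookup-injective uniq i j (f-inj (∈-lookup i) (∈-lookup j) eq)

  length≡length-filter+length-filter-∁ : {P : A → Set} (P? : Decidable P) (xs : List A) →
    length xs ≡ length (filter P? xs) + length (filter (∁? P?) xs)
  length≡length-filter+length-filter-∁ P? []       = refl
  length≡length-filter+length-filter-∁ P? (x ∷ xs) with P? x
  ... | yes _ = cong suc (length≡length-filter+length-filter-∁ P? xs)
  ... | no _  = trans (cong suc (length≡length-filter+length-filter-∁ P? xs)) (sym (+-suc _ _))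

  tabulate-injectiveOn : ∀ {n B} (g : Fin n → A) (k : A → B) (h : B → Fin n) →
    (∀ i → h (k (g i)) ≡ i) → InjectiveOn k (tabulate g)
  tabulate-injectiveOn g k h hkg≗id x∈ y∈ kx≡ky with ∈-tabulate⁻ x∈ | ∈-tabulate⁻ y∈
  ... | i , refl | j , refl = cong g (begin
    i             ≡⟨ sym (hkg≗id i) ⟩
    h (k (g i))   ≡⟨ cong h kx≡ky ⟩
    h (k (g j))   ≡⟨ hkg≗id j ⟩
    j             ∎)
    where open ≡-Reasoning

module _ (G : Graph) where

  tail head : E G → V G
  tail e = proj₁ (ends G e)
  head e = proj₂ (ends G e)

  IsTwoPacking⇒incident-length≤2 : ∀ {R L x} → IsTwoPacking G R → Unique L →
    (∀ {e} → e ∈ L → e ∈ R) → All (λ e → Incident G e x) L → length L ≤ 2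
  IsTwoPacking⇒incident-length≤2 {L = []}          _ _ _ _ = z≤n
  IsTwoPacking⇒incident-length≤2 {L = _ ∷ []}      _ _ _ _ = s≤s z≤n
  IsTwoPacking⇒incident-length≤2 {L = _ ∷ _ ∷ []}  _ _ _ _ = s≤s (s≤s z≤n)
  IsTwoPacking⇒incident-length≤2 {L = a ∷ b ∷ c ∷ _} {x} (_ , noClaw)
    ((a≢b ∷ a≢c ∷ _) ∷ (b≢c ∷ _) ∷ _) L⊆R (xa ∷ xb ∷ xc ∷ _) =
    ⊥-elim (noClaw x a b c (L⊆R (here refl)) (L⊆R (there (here refl)))
      (L⊆R (there (there (here refl)))) xa xb xc a≢b a≢c b≢c)

  -- Of three edges of R at a vertex, two meet it in the same role (tail or head).
  injectiveTails×Heads⇒IsTwoPacking : ∀ {R} → Unique R →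
    InjectiveOn tail R → InjectiveOn head R → IsTwoPacking G R
  injectiveTails×Heads⇒IsTwoPacking {R} uniq tail-inj head-inj = uniq , noClaw
    where
    noClaw : ∀ x e₁ e₂ e₃ → e₁ ∈ R → e₂ ∈ R → e₃ ∈ R →
      Incident G e₁ x → Incident G e₂ x → Incident G e₃ x →
      ¬ e₁ ≡ e₂ → ¬ e₁ ≡ e₃ → ¬ e₂ ≡ e₃ → ⊥
    noClaw _ _ _ _ m₁ m₂ m₃ (inj₁ a) (inj₁ b) _        ≢₁₂ _   _   = ≢₁₂ (tail-inj m₁ m₂ (trans a (sym b)))
    noClaw _ _ _ _ m₁ m₂ m₃ (inj₂ a) (inj₂ b) _        ≢₁₂ _   _   = ≢₁₂ (head-inj m₁ m₂ (trans a (sym b)))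
    noClaw _ _ _ _ m₁ m₂ m₃ (inj₁ a) (inj₂ b) (inj₁ c) _   ≢₁₃ _   = ≢₁₃ (tail-inj m₁ m₃ (trans a (sym c)))
    noClaw _ _ _ _ m₁ m₂ m₃ (inj₁ a) (inj₂ b) (inj₂ c) _   _   ≢₂₃ = ≢₂₃ (head-inj m₂ m₃ (trans b (sym c)))
    noClaw _ _ _ _ m₁ m₂ m₃ (inj₂ a) (inj₁ b) (inj₁ c) _   _   ≢₂₃ = ≢₂₃ (tail-inj m₂ m₃ (trans b (sym c)))
    noClaw _ _ _ _ m₁ m₂ m₃ (inj₂ a) (inj₁ b) (inj₂ c) _   ≢₁₃ _   = ≢₁₃ (head-inj m₁ m₃ (trans a (sym c)))

module _ (s t : ℕ) where

  data AtV₂ : TEdge s t → Set where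
    v₁v₂   : AtV₂ (path (suc zero))
    v₂v₃   : AtV₂ (path (suc (suc zero)))
    v₂wᵢ   : ∀ {i} → AtV₂ (v2w i)
    v₂pᵢ   : ∀ {i} → AtV₂ (v2p i)

  atV₂? : Decidable AtV₂
  atV₂? (path zero)                   = no λ ()
  atV₂? (path (suc zero))             = yes v₁v₂
  atV₂? (path (suc (suc zero)))       = yes v₂v₃
  atV₂? (path (suc (suc (suc zero)))) = no λ ()
  atV₂? (pq _)                        = no λ ()
  atV₂? (v2w _)                       = yes v₂wᵢ
  atV₂? (v2p _)                       = yes v₂pᵢ

  AtV₂⇒incident : ∀ {e} → AtV₂ e → Incident (T s t) e (v v₂)
  AtV₂⇒incident v₁v₂ = inj₂ refl
  AtV₂⇒incident v₂v₃ = inj₁ refl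
  AtV₂⇒incident v₂wᵢ = inj₁ refl
  AtV₂⇒incident v₂pᵢ = inj₁ refl

  avoidingIndex : TEdge s t → Fin (2 + s)
  avoidingIndex (path zero)    = zero
  avoidingIndex (path (suc _)) = suc zero
  avoidingIndex (pq i)         = suc (suc i)
  avoidingIndex (v2w _)        = zero
  avoidingIndex (v2p _)        = zero

  avoidingEdge : Fin (2 + s) → TEdge s t
  avoidingEdge zero          = path zero
  avoidingEdge (suc zero)    = path (suc (suc (suc zero)))
  avoidingEdge (suc (suc i)) = pq i

  avoidingEdge-avoidingIndex : ∀ {e} → ¬ AtV₂ e → avoidingEdge (avoidingIndex e) ≡ e
  avoidingEdge-avoidingIndex {path zero}                   _   = refl
  avoidingEdge-avoidingIndex {path (suc zero)}             ¬at = ⊥-elim (¬at v₁v₂)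
  avoidingEdge-avoidingIndex {path (suc (suc zero))}       ¬at = ⊥-elim (¬at v₂v₃)
  avoidingEdge-avoidingIndex {path (suc (suc (suc zero)))} _   = refl
  avoidingEdge-avoidingIndex {pq _}                        _   = refl
  avoidingEdge-avoidingIndex {v2w _}                       ¬at = ⊥-elim (¬at v₂wᵢ)
  avoidingEdge-avoidingIndex {v2p _}                       ¬at = ⊥-elim (¬at v₂pᵢ)

  avoidingIndex-injectiveOn : ∀ R → InjectiveOn avoidingIndex (filter (∁? atV₂?) R)
  avoidingIndex-injectiveOn R {e} {e′} e∈ e′∈ eq = begin
    e                               ≡⟨ sym (avoidingEdge-avoidingIndex (avoids e∈)) ⟩
    avoidingEdge (avoidingIndex e)  ≡⟨ cong avoidingEdge eq ⟩
    avoidingEdge (avoidingIndex e′) ≡⟨ avoidingEdge-avoidingIndex (avoids e′∈) ⟩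
    e′                              ∎
    where
    open ≡-Reasoning
    avoids : ∀ {d} → d ∈ filter (∁? atV₂?) R → ¬ AtV₂ d
    avoids d∈ = proj₂ (∈-filter⁻ (∁? atV₂?) {xs = R} d∈)

  IsTwoPacking⇒length≤ : ∀ R → IsTwoPacking (T s t) R → length R ≤ s + 4
  IsTwoPacking⇒length≤ R packing@(uniq , _) = begin
    length R                                                 ≡⟨ length≡length-filter+length-filter-∁ atV₂? R ⟩
    length (filter atV₂? R) + length (filter (∁? atV₂?) R)   ≤⟨ +-mono-≤ atV₂-count avoiding-count ⟩
    2 + (2 + s)                                              ≡⟨ +-comm 4 s ⟩
    s + 4                                                    ∎
    where
    open ≤-Reasoning
    atV₂-count : length (filter atV₂? R) ≤ 2
    atV₂-count = IsTwoPacking⇒incident-length≤2 (T s t) packing (filter⁺ atV₂? uniq)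
      (λ e∈ → proj₁ (∈-filter⁻ atV₂? e∈))
      (All.map AtV₂⇒incident (all-filter atV₂? R))
    avoiding-count : length (filter (∁? atV₂?) R) ≤ 2 + s
    avoiding-count = Unique-length≤ avoidingIndex (avoidingIndex-injectiveOn R) (filter⁺ (∁? atV₂?) uniq)

  pathOrMatching : Fin (4 + s) → TEdge s t
  pathOrMatching zero                      = path zero
  pathOrMatching (suc zero)                = path (suc zero)
  pathOrMatching (suc (suc zero))          = path (suc (suc zero))
  pathOrMatching (suc (suc (suc zero)))    = path (suc (suc (suc zero)))
  pathOrMatching (suc (suc (suc (suc i)))) = pq i

  tailIndex : TVertex s t → Fin (4 + s)
  tailIndex (v (suc zero))             = suc zero
  tailIndex (v (suc (suc zero)))       = suc (suc zero)
  tailIndex (v (suc (suc (suc zero)))) = suc (suc (suc zero))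
  tailIndex (p i)                      = suc (suc (suc (suc i)))
  tailIndex _                          = zero

  headIndex : TVertex s t → Fin (4 + s)
  headIndex (v (suc (suc zero)))             = suc zero
  headIndex (v (suc (suc (suc zero))))       = suc (suc zero)
  headIndex (v (suc (suc (suc (suc zero))))) = suc (suc (suc zero))
  headIndex (q i)                            = suc (suc (suc (suc i)))
  headIndex _                                = zero

  tailIndex-pathOrMatching : ∀ i → tailIndex (tail (T s t) (pathOrMatching i)) ≡ i
  tailIndex-pathOrMatching zero                      = refl
  tailIndex-pathOrMatching (suc zero)                = refl
  tailIndex-pathOrMatching (suc (suc zero))          = refl
  tailIndex-pathOrMatching (suc (suc (suc zero)))    = refl
  tailIndex-pathOrMatching (suc (suc (suc (suc i)))) = refl

  headIndex-pathOrMatching : ∀ i → headIndex (head (T s t) (pathOrMatching i)) ≡ i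
  headIndex-pathOrMatching zero                      = refl
  headIndex-pathOrMatching (suc zero)                = refl
  headIndex-pathOrMatching (suc (suc zero))          = refl
  headIndex-pathOrMatching (suc (suc (suc zero)))    = refl
  headIndex-pathOrMatching (suc (suc (suc (suc i)))) = refl

  pathOrMatching-injective : ∀ {i j} → pathOrMatching i ≡ pathOrMatching j → i ≡ j
  pathOrMatching-injective {i} {j} eq = begin
    i                                          ≡⟨ sym (tailIndex-pathOrMatching i) ⟩
    tailIndex (tail (T s t) (pathOrMatching i)) ≡⟨ cong (λ e → tailIndex (tail (T s t) e)) eq ⟩
    tailIndex (tail (T s t) (pathOrMatching j)) ≡⟨ tailIndex-pathOrMatching j ⟩
    j                                          ∎
    where open ≡-Reasoning

  pathOrMatching-isTwoPacking : IsTwoPacking (T s t) (tabulate pathOrMatching)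
  pathOrMatching-isTwoPacking = injectiveTails×Heads⇒IsTwoPacking (T s t)
    (tabulate⁺ pathOrMatching-injective)
    (tabulate-injectiveOn pathOrMatching (tail (T s t)) tailIndex tailIndex-pathOrMatching)
    (tabulate-injectiveOn pathOrMatching (head (T s t)) headIndex headIndex-pathOrMatching)

proposition2p3 : (s t : ℕ) → 1 Data.Nat.≤ s → 1 Data.Nat.≤ t →
    TwoPackingNumberIs (T s t) (s + 4)
proposition2p3 s t _ _ =
  (tabulate (pathOrMatching s t) , pathOrMatching-isTwoPacking s t , length-pathOrMatching) ,
  IsTwoPacking⇒length≤ s t
  where
  length-pathOrMatching : length (tabulate (pathOrMatching s t)) ≡ s + 4
  length-pathOrMatching = trans (length-tabulate (pathOrMatching s t)) (+-comm 4 s)
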